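{- Let $G$ be a connected graph of order $n\ge 4$ with $rx_4(G)=3$. Then $\overline{G}$ contains neither $C_4$ nor $C_5$ as a subgraph.
   Context: For a connected graph $G$, an edge-coloring $c:E(G)\to\{1,\dots,q\}$ (adjacent edges may get the same color) is a $4$-rainbow coloring if for every set $S$ of $4$ vertices there is a tree in $G$ containing $S$ whose edges have pairwise distinct colors. $rx_4(G)$ is the minimum $q$ for which such a coloring exists. $\overline{G}$ is the complement of $G$; $C_m$ is the cycle on $m$ vertices. -}

module Defs where

open import Data.Nat using (ℕ; _<_)
open import Data.Fin using (Fin)
open import Data.Product using (Σ; _×_; _,_; ∃; ∃-syntax)
open import Data.List using (List; []; _∷_; [_]; map; length)
open import Data.List.Membership.Propositional using (_∈_; _∉_)
open import Data.List.Relation.Unary.Unique.Propositional using (Unique)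
open import Data.List.Relation.Unary.All using (All)
open import Relation.Binary.PropositionalEquality using (_≡_; _≢_)
open import Relation.Nullary using (¬_)
open import Level using (0ℓ; suc)

record Graph (n : ℕ) : Set₁ where
  field
    Adj     : Fin n → Fin n → Set
    sym     : ∀ {u v} → Adj u v → Adj v u
    irrefl  : ∀ {v} → ¬ Adj v v
open Graph public

complement : ∀ {n} → Graph n → Graph n
complement G = record
  { Adj    = λ u v → (u ≢ v) × ¬ Adj G u v
  ; sym    = λ { (u≢v , ¬a) → (λ e → u≢v (Relation.Binary.PropositionalEquality.sym e)) , (λ a → ¬a (Graph.sym G a)) }
  ; irrefl = λ { (v≢v , _) → v≢v Relation.Binary.PropositionalEquality.refl }
  }

data Walk {n} (G : Graph n) : Fin n → Fin n → Set where
  here : ∀ {v} → Walk G v v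
  step : ∀ {u v w} → Adj G u v → Walk G v w → Walk G u w

Connected : ∀ {n} → Graph n → Set
Connected G = ∀ u v → Walk G u v

data Tree {n} (G : Graph n) : List (Fin n) → List (Fin n × Fin n) → Set where
  single : ∀ v → Tree G [ v ] []
  grow   : ∀ {Vs Es} u w → Tree G Vs Es → u ∈ Vs → w ∉ Vs → Adj G u w →
           Tree G (w ∷ Vs) ((u , w) ∷ Es)

-- An edge-colouring with q colours: a symmetric assignment of a colour to
-- every pair of vertices (values on non-edges are irrelevant).
record EdgeColouring (n q : ℕ) : Set where
  field
    col    : Fin n → Fin n → Fin q
    colSym : ∀ u v → col u v ≡ col v u
open EdgeColouring public

edgeColours : ∀ {n q} → EdgeColouring n q → List (Fin n × Fin n) → List (Fin q)
edgeColours c = map (λ { (u , w) → col c u w })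

Is4Rainbow : ∀ {n q} → Graph n → EdgeColouring n q → Set
Is4Rainbow {n} G c =
  (S : List (Fin n)) → Unique S → length S ≡ 4 →
  ∃[ Vs ] ∃[ Es ] (Tree G Vs Es × All (_∈ Vs) S × Unique (edgeColours c Es))

Has4RainbowColouring : ∀ {n} → Graph n → ℕ → Set
Has4RainbowColouring {n} G q = Σ (EdgeColouring n q) (Is4Rainbow G)

rx4≡ : ∀ {n} → Graph n → ℕ → Set
rx4≡ G k = Has4RainbowColouring G k × (∀ q → q < k → ¬ Has4RainbowColouring G q)

ContainsC4 : ∀ {n} → Graph n → Set
ContainsC4 {n} H = ∃[ a ] ∃[ b ] ∃[ c ] ∃[ d ]
  (Unique (a ∷ b ∷ c ∷ d ∷ []) ×
   Adj H a b × Adj H b c × Adj H c d × Adj H d a)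

ContainsC5 : ∀ {n} → Graph n → Set
ContainsC5 {n} H = ∃[ a ] ∃[ b ] ∃[ c ] ∃[ d ] ∃[ e ]
  (Unique (a ∷ b ∷ c ∷ d ∷ e ∷ []) ×
   Adj H a b × Adj H b c × Adj H c d × Adj H d e × Adj H e a)

-- With three colours a rainbow tree has at most three edges, hence at most four
-- vertices; so a rainbow tree through four given vertices S spans exactly S and
-- consists of three edges of G[S] with three distinct colours.  If the
-- complement contains a 4-cycle a b c d, then G[S] has at most the two edges
-- ac and bd, which carry at most two colours.  If the complement contains a
-- 5-cycle a b c d e, then G restricted to these vertices is contained in the
-- pentagon a c e b d; any four consecutive vertices of the pentagon induce at
-- most a path, whose three edges must be rainbow, and three such paths make
-- four of the pentagon edges pairwise differently coloured: too many for
-- three colours.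
module Submission where

open import Defs hiding (sym)
open import Data.Nat using (ℕ; suc; _≤_; _≥_; z≤n; s≤s; s≤s⁻¹)
open import Data.Nat.Properties using (≤⇒≯; <-irrefl)
open import Data.Fin using (Fin; _≟_)
open import Data.Product using (_×_; _,_; ∃-syntax)
open import Data.List using (List; []; _∷_; length)
open import Data.List.Properties using (length-map; length-tabulate)
open import Data.List.Membership.Propositional using (_∈_)
open import Data.List.Membership.Propositional.Properties using (∈-allFin)
open import Data.List.Relation.Unary.Any using (here; there)
open import Data.List.Relation.Unary.All as All using (All; []; _∷_)
open import Data.List.Relation.Unary.All.Properties using (map⁺; ¬Any⇒All¬)
open import Data.List.Relation.Unary.AllPairs using ([]; _∷_)
open import Data.List.Relation.Unary.Unique.Propositional using (Unique)
open import Data.Empty using (⊥-elim)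
open import Function using (id; _∘_)
open import Relation.Nullary using (¬_)
open import Relation.Nullary.Decidable using (decidable-stable)
open import Relation.Binary.PropositionalEquality
  using (_≡_; _≢_; refl; sym; trans; cong; subst; ≢-sym)

private variable
  A : Set

∈-remove : {x : A} {ys : List A} → x ∈ ys →
  ∃[ ys′ ] length ys ≡ suc (length ys′) × (∀ {z} → z ∈ ys → z ≢ x → z ∈ ys′)
∈-remove {ys = _ ∷ ys} (here refl) =
  ys , refl , λ { (here refl) z≢z → ⊥-elim (z≢z refl) ; (there z∈) _ → z∈ }
∈-remove {ys = y ∷ _} (there x∈) with ys′ , eq , keep ← ∈-remove x∈ =
  y ∷ ys′ , cong suc eq , λ { (here refl) _ → here refl ; (there z∈) z≢x → there (keep z∈ z≢x) }

Unique⇒length≤ : {xs ys : List A} → Unique xs → All (_∈ ys) xs → length xs ≤ length ys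
Unique⇒length≤ [] [] = z≤n
Unique⇒length≤ {ys = ys} (x∉xs ∷ uxs) (x∈ys ∷ xs⊆ys)
  with ys′ , eq , keep ← ∈-remove x∈ys =
  subst (_ ≤_) (sym eq)
    (s≤s (Unique⇒length≤ uxs (All.zipWith (λ (x≢z , z∈ys) → keep z∈ys (≢-sym x≢z)) (x∉xs , xs⊆ys))))

Unique⇒length≤-Fin : ∀ {q} {ks : List (Fin q)} → Unique ks → length ks ≤ q
Unique⇒length≤-Fin {q} {ks} uks =
  subst (length ks ≤_) (length-tabulate id) (Unique⇒length≤ uks (All.tabulate λ {k} _ → ∈-allFin k))

ThreeDistinctIn : List A → Set
ThreeDistinctIn L = ∃[ ks ] Unique ks × 3 ≤ length ks × All (_∈ L) ks

¬ThreeDistinctIn-pair : {a b : A} → ¬ ThreeDistinctIn (a ∷ b ∷ [])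
¬ThreeDistinctIn-pair (_ , uks , 3≤ks , ks⊆ab) = ≤⇒≯ (Unique⇒length≤ uks ks⊆ab) 3≤ks

ThreeDistinctIn⇒Unique : {x y z : A} → ThreeDistinctIn (x ∷ y ∷ z ∷ []) → Unique (x ∷ y ∷ z ∷ [])
ThreeDistinctIn⇒Unique {x = x} {y} {z} (ks , uks , 3≤ks , ks⊆xyz) =
  (x≢y ∷ x≢z ∷ []) ∷ (y≢z ∷ []) ∷ [] ∷ []
  where
  impossible : ∀ {a b} → ¬ All (_∈ a ∷ b ∷ []) ks
  impossible ks⊆ab = ¬ThreeDistinctIn-pair (ks , uks , 3≤ks , ks⊆ab)
  x≢y : x ≢ y
  x≢y = λ x≡y → impossible (All.map (λ { (here e) → here e
                                         ; (there (here e)) → here (trans e (sym x≡y))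
                                         ; (there (there k∈)) → there k∈ }) ks⊆xyz)
  y≢z : y ≢ z
  y≢z = λ y≡z → impossible (All.map (λ { (here e) → here e
                                         ; (there (here e)) → there (here e)
                                         ; (there (there (here e))) → there (here (trans e (sym y≡z)))
                                         ; (there (there (there ()))) }) ks⊆xyz)
  x≢z : x ≢ z
  x≢z = λ x≡z → impossible (All.map (λ { (here e) → here e
                                         ; (there (here e)) → there (here e)
                                         ; (there (there (here e))) → here (trans e (sym x≡z))
                                         ; (there (there (there ()))) }) ks⊆xyz)

module _ {n} (G : Graph n) where

  EdgeWithin : List (Fin n) → Fin n × Fin n → Set
  EdgeWithin Vs (u , w) = u ∈ Vs × w ∈ Vs × Adj G u w

  Tree-length : ∀ {Vs Es} → Tree G Vs Es → length Vs ≡ suc (length Es)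
  Tree-length (single _)         = refl
  Tree-length (grow _ _ t _ _ _) = cong suc (Tree-length t)

  Tree-edges : ∀ {Vs Es} → Tree G Vs Es → All (EdgeWithin Vs) Es
  Tree-edges (single _) = []
  Tree-edges (grow _ _ t u∈ _ adj) =
    (there u∈ , here refl , adj) ∷ All.map (λ (u∈ , w∈ , a) → there u∈ , there w∈ , a) (Tree-edges t)

  Adj-within₄ : (P : Fin n → Fin n → Set) → (∀ {u w} → P u w → P w u) → ∀ {a b c d} →
    (Adj G a b → P a b) → (Adj G a c → P a c) → (Adj G a d → P a d) →
    (Adj G b c → P b c) → (Adj G b d → P b d) → (Adj G c d → P c d) →
    ∀ {u w} → u ∈ a ∷ b ∷ c ∷ d ∷ [] → w ∈ a ∷ b ∷ c ∷ d ∷ [] → Adj G u w → P u w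
  Adj-within₄ P P-sym ab ac ad bc bd cd = within
    where
    within : ∀ {u w} → u ∈ _ → w ∈ _ → Adj G u w → P u w
    within (here refl)                 (here refl)                         = ⊥-elim ∘ irrefl G
    within (here refl)                 (there (here refl))                 = ab
    within (here refl)                 (there (there (here refl)))         = ac
    within (here refl)                 (there (there (there (here refl)))) = ad
    within (there (here refl))         (here refl)                         = P-sym ∘ ab ∘ Graph.sym G
    within (there (here refl))         (there (here refl))                 = ⊥-elim ∘ irrefl G
    within (there (here refl))         (there (there (here refl)))         = bc
    within (there (here refl))         (there (there (there (here refl)))) = bd
    within (there (there (here refl))) (here refl)                         = P-sym ∘ ac ∘ Graph.sym G
    within (there (there (here refl))) (there (here refl))                 = P-sym ∘ bc ∘ Graph.sym G
    within (there (there (here refl))) (there (there (here refl)))         = ⊥-elim ∘ irrefl G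
    within (there (there (here refl))) (there (there (there (here refl)))) = cd
    within (there (there (there (here refl)))) (here refl)                 = P-sym ∘ ad ∘ Graph.sym G
    within (there (there (there (here refl)))) (there (here refl))         = P-sym ∘ bd ∘ Graph.sym G
    within (there (there (there (here refl)))) (there (there (here refl))) = P-sym ∘ cd ∘ Graph.sym G
    within (there (there (there (here refl)))) (there (there (there (here refl)))) = ⊥-elim ∘ irrefl G
    within (there (there (there (there ())))) _
    within _ (there (there (there (there ()))))

module _ {n q} {G : Graph n} (χ : EdgeColouring n q) where
  open import Data.List.Membership.DecPropositional (_≟_ {n}) using (_∈?_)

  rainbowTree-spans : ∀ {Vs Es S} → Tree G Vs Es → Unique (edgeColours χ Es) →
    Unique S → All (_∈ Vs) S → length S ≡ suc q →
    (∀ {v} → v ∈ Vs → v ∈ S) × q ≤ length Es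
  rainbowTree-spans {Vs} {Es} {S} t uχ uS S⊆Vs |S| = Vs⊆S , q≤Es
    where
    Es≤q : length Es ≤ q
    Es≤q = subst (_≤ q) (length-map _ Es) (Unique⇒length≤-Fin uχ)
    bound : ∀ {xs} → Unique xs → All (_∈ Vs) xs → length xs ≤ suc (length Es)
    bound {xs} uxs xs⊆Vs = subst (length xs ≤_) (Tree-length G t) (Unique⇒length≤ uxs xs⊆Vs)
    q≤Es : q ≤ length Es
    q≤Es = s≤s⁻¹ (subst (_≤ suc (length Es)) |S| (bound uS S⊆Vs))
    Vs⊆S : ∀ {v} → v ∈ Vs → v ∈ S
    Vs⊆S {v} v∈Vs = decidable-stable (v ∈? S) λ v∉S →
      ≤⇒≯ Es≤q (s≤s⁻¹ (subst (_≤ suc (length Es)) (cong suc |S|)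
                         (bound (¬Any⇒All¬ S v∉S ∷ uS) (v∈Vs ∷ S⊆Vs))))

module _ {n} (G : Graph n) (χ : EdgeColouring n 3) (rainbow : Is4Rainbow G χ) where

  rainbow-colours-within : ∀ {S L} → Unique S → length S ≡ 4 →
    (∀ {u w} → u ∈ S → w ∈ S → Adj G u w → col χ u w ∈ L) → ThreeDistinctIn L
  rainbow-colours-within uS |S| covered
    with Vs , Es , t , S⊆Vs , uχ ← rainbow _ uS |S|
    with Vs⊆S , 3≤Es ← rainbowTree-spans χ t uχ uS S⊆Vs |S| =
    edgeColours χ Es , uχ , subst (3 ≤_) (sym (length-map _ Es)) 3≤Es ,
    map⁺ (All.map (λ { {_ , _} (u∈ , w∈ , a) → covered (Vs⊆S u∈) (Vs⊆S w∈) a }) (Tree-edges G t))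

  colour∈-sym : ∀ {L} {u w} → col χ u w ∈ L → col χ w u ∈ L
  colour∈-sym {L} {u} {w} = subst (_∈ L) (colSym χ u w)

  path-rainbow : ∀ {p q r s} → Unique (p ∷ q ∷ r ∷ s ∷ []) →
    ¬ Adj G p r → ¬ Adj G p s → ¬ Adj G q s →
    Unique (col χ p q ∷ col χ q r ∷ col χ r s ∷ [])
  path-rainbow {p} {q} {r} {s} uS ¬pr ¬ps ¬qs =
    ThreeDistinctIn⇒Unique (rainbow-colours-within uS refl
      (Adj-within₄ G (λ u w → col χ u w ∈ col χ p q ∷ col χ q r ∷ col χ r s ∷ []) colour∈-sym
        (λ _ → here refl) (⊥-elim ∘ ¬pr) (⊥-elim ∘ ¬ps)
        (λ _ → there (here refl)) (⊥-elim ∘ ¬qs)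
        (λ _ → there (there (here refl)))))

  no-C4 : ¬ ContainsC4 (complement G)
  no-C4 (a , b , c , d , uS , (_ , ¬ab) , (_ , ¬bc) , (_ , ¬cd) , (_ , ¬da)) =
    ¬ThreeDistinctIn-pair (rainbow-colours-within uS refl
      (Adj-within₄ G (λ u w → col χ u w ∈ col χ a c ∷ col χ b d ∷ []) colour∈-sym
        (⊥-elim ∘ ¬ab) (λ _ → here refl) (⊥-elim ∘ ¬da ∘ Graph.sym G)
        (⊥-elim ∘ ¬bc) (λ _ → there (here refl))
        (⊥-elim ∘ ¬cd)))

  -- κ₁ … κ₅ are the colours of the pentagon edges ac, ce, eb, bd, da of G.
  no-C5 : ¬ ContainsC5 (complement G)
  no-C5 (a , b , c , d , e
        , ((a≢b ∷ a≢c ∷ a≢d ∷ a≢e ∷ []) ∷ (b≢c ∷ b≢d ∷ b≢e ∷ []) ∷ (c≢d ∷ c≢e ∷ []) ∷ (d≢e ∷ []) ∷ [] ∷ [])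
        , (_ , ¬ab) , (_ , ¬bc) , (_ , ¬cd) , (_ , ¬de) , (_ , ¬ea))
    with (κ₂≢κ₃ ∷ κ₂≢κ₄ ∷ []) ∷ (κ₃≢κ₄ ∷ []) ∷ [] ∷ [] ← path-rainbow {c} {e} {b} {d}
           ((c≢e ∷ ≢-sym b≢c ∷ c≢d ∷ []) ∷ (≢-sym b≢e ∷ ≢-sym d≢e ∷ []) ∷ (b≢d ∷ []) ∷ [] ∷ [])
           (¬bc ∘ Graph.sym G) ¬cd (¬de ∘ Graph.sym G)
    with (_ ∷ κ₃≢κ₅ ∷ []) ∷ (κ₄≢κ₅ ∷ []) ∷ [] ∷ [] ← path-rainbow {e} {b} {d} {a}
           ((≢-sym b≢e ∷ ≢-sym d≢e ∷ ≢-sym a≢e ∷ []) ∷ (b≢d ∷ ≢-sym a≢b ∷ []) ∷ (≢-sym a≢d ∷ []) ∷ [] ∷ [])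
           (¬de ∘ Graph.sym G) ¬ea (¬ab ∘ Graph.sym G)
    with (_ ∷ κ₅≢κ₂ ∷ []) ∷ _ ← path-rainbow {d} {a} {c} {e}
           ((≢-sym a≢d ∷ ≢-sym c≢d ∷ d≢e ∷ []) ∷ (a≢c ∷ a≢e ∷ []) ∷ (c≢e ∷ []) ∷ [] ∷ [])
           (¬cd ∘ Graph.sym G) ¬de (¬ea ∘ Graph.sym G)
    = <-irrefl refl (Unique⇒length≤-Fin
        ((κ₂≢κ₃ ∷ κ₂≢κ₄ ∷ ≢-sym κ₅≢κ₂ ∷ []) ∷ (κ₃≢κ₄ ∷ κ₃≢κ₅ ∷ []) ∷ (κ₄≢κ₅ ∷ []) ∷ [] ∷ []))

-- Only rx₄(G) ≤ 3 is needed: the order, connectivity and minimality hypotheses are unused.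
proposition2p4 : (n : ℕ) → n ≥ 4 → (G : Graph n) → Connected G → rx4≡ G 3 →
    ¬ ContainsC4 (complement G) × ¬ ContainsC5 (complement G)
proposition2p4 _ _ G _ ((χ , rainbow) , _) = no-C4 G χ rainbow , no-C5 G χ rainbow
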